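{- Let $k\geq 2$ and let $G_k$ be the weighted directed graph defined below for $\ell=1$ with blue edge weight $-n$, where $n=k$. Then the maximum weight of a directed path from node $0$ to node $2^k-1$ in $G_k$ is $0$.
   Context: The pruning function $\operatorname{P}_{1}:\mathbb{Z}_{>0}\to\mathbb{Z}_{\geq 0}$: write $m$ in binary, padded on the left with zeros as needed, let $z$ be the position (position $0$ = least significant bit) of the first zero bit counted from the right, let $q = 2^{z}\lfloor m/2^{z}\rfloor$, and set $\operatorname{P}_1(m)=\max(q-1,0)$. For integers $k\ge 2$ and $n$, $G_k$ is the weighted directed graph with node set $\{0\}\cup\{2^{k-1}-1,2^{k-1},\ldots,2^k-1\}$ and the following edges: for each $m$ with $2^{k-1}-1\le m<2^k-1$, a "blue" edge from $m$ to $m+1$ of weight $-n$, and a "red" edge from $\operatorname{P}_1(m)$ to $m$ of weight $+1$. The weight of a path is the sum of the weights of its edges. -}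

module Defs where

open import Data.Nat using (ℕ; zero; suc; _+_; _*_; _∸_; _^_; _≤_; _<_)
open import Data.Nat.DivMod using (_/_; _%_)
open import Data.Nat.Properties using (m^n≢0)
open import Data.Integer as ℤ using (ℤ; +_; -_)

-- Number of trailing one bits of m, computed with fuel f
-- (fuel m is always sufficient, since the count is at most log2 (m+1) ≤ m).
trailingOnesFuel : ℕ → ℕ → ℕ
trailingOnesFuel zero    m = 0
trailingOnesFuel (suc f) m with m % 2
... | 1 = suc (trailingOnesFuel f (m / 2))
... | _ = 0

firstZeroPos : ℕ → ℕ
firstZeroPos m = trailingOnesFuel m m

P₁ : ℕ → ℕ
P₁ m = (2 ^ z * (_/_ m (2 ^ z) {{m^n≢0 2 z}})) ∸ 1
  where z = firstZeroPos m

-- Edges of G_k with blue edge weight -n: Edge k n u v w means an edge u → v of weight w.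
data Edge (k n : ℕ) : ℕ → ℕ → ℤ → Set where
  blue : ∀ m → 2 ^ (k ∸ 1) ∸ 1 ≤ m → m < 2 ^ k ∸ 1 → Edge k n m (suc m) (- (+ n))
  red  : ∀ m → 2 ^ (k ∸ 1) ∸ 1 ≤ m → m < 2 ^ k ∸ 1 → Edge k n (P₁ m) m (+ 1)

data Path (k n : ℕ) : ℕ → ℕ → Set where
  []  : ∀ {u} → Path k n u u
  _∷_ : ∀ {u v t w} → Edge k n u v w → Path k n v t → Path k n u t

edgeWeight : ∀ {k n u v w} → Edge k n u v w → ℤ
edgeWeight {w = w} _ = w

weight : ∀ {k n u v} → Path k n u v → ℤ
weight []       = + 0
weight (e ∷ p) = edgeWeight e ℤ.+ weight p

module Submission where

-- Let the pruning depth of m be the number of applications of P₁ that take m to 0.  Since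
-- P₁ (2b) = 2b − 1 and P₁ (2b + 1) = 2c − 1 for an even c ≤ b, the depth of 2b + 1 equals that
-- of b when b ≥ 1, and so every m < 2ᵏ has depth at most k.  A red edge P₁ m → m raises the
-- depth by exactly one and a blue edge (weight −k) lowers it by at most k, so with the depth as
-- potential ψ, reset to 0 at the target 2ᵏ − 1, every edge u → v has weight at most ψ v − ψ u,
-- and every path from 0 to 2ᵏ − 1 has weight at most 0.  The bound is attained by the k red edges
-- 0 → 01ᵏ⁻¹ → 101ᵏ⁻² → ⋯ → 1ᵏ⁻¹0 followed by the blue edge to 1ᵏ.

open import Defs
open import Data.Nat using (ℕ; zero; suc; _+_; _*_; _∸_; _^_; _≤_; _<_; z≤n; s≤s; NonZero)
open import Data.Nat.Properties
open import Data.Nat.DivMod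
open import Data.Nat.Induction using (<-wellFounded)
open import Induction.WellFounded using (Acc; acc)
open import Data.Product using (Σ; ∃-syntax; _×_; _,_)
open import Data.Integer as ℤ using (ℤ; +_; -_; +≤+)
import Data.Integer.Properties as ℤ
open import Relation.Binary.PropositionalEquality
open import Function using (_∘_)
open import Relation.Nullary using (yes; no; contradiction)

data ParityView : ℕ → Set where
  even : ∀ b → ParityView (b * 2)
  odd  : ∀ b → ParityView (1 + b * 2)

parityView : ∀ m → ParityView m
parityView zero = even 0
parityView (suc m) with parityView m
... | even b = odd b
... | odd b  = even (suc b)

[1+b*2]/2≡b : ∀ b → (1 + b * 2) / 2 ≡ b
[1+b*2]/2≡b b = begin
  (1 + b * 2) / 2  ≡⟨ +-distrib-/ 1 (b * 2) (subst (λ r → 1 + r < 2) (sym (m*n%n≡0 b 2)) ≤-refl) ⟩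
  0 + b * 2 / 2    ≡⟨ m*n/n≡m b 2 ⟩
  b                ∎
  where open ≡-Reasoning

trailingOnesFuel-irrelevant : ∀ f g m → m ≤ f → m ≤ g → trailingOnesFuel f m ≡ trailingOnesFuel g m
trailingOnesFuel-irrelevant zero    zero    _       _       _       = refl
trailingOnesFuel-irrelevant zero    (suc g) zero    _       _       = refl
trailingOnesFuel-irrelevant (suc f) zero    zero    _       _       = refl
trailingOnesFuel-irrelevant (suc f) (suc g) zero    _       _       = refl
trailingOnesFuel-irrelevant (suc f) (suc g) (suc m) (s≤s m≤f) (s≤s m≤g) with suc m % 2
... | 1           =
  cong suc (trailingOnesFuel-irrelevant f g (suc m / 2) (≤-trans half≤m m≤f) (≤-trans half≤m m≤g))
  where
  half≤m : suc m / 2 ≤ m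
  half≤m = <⇒≤pred (m/n<m (suc m) 2 ≤-refl)
... | 0           = refl
... | suc (suc _) = refl

firstZeroPos-even : ∀ b → firstZeroPos (b * 2) ≡ 0
firstZeroPos-even b with b * 2 | m*n%n≡0 b 2
... | zero  | _ = refl
... | suc _ | r≡0 rewrite r≡0 = refl

firstZeroPos-odd : ∀ b → firstZeroPos (1 + b * 2) ≡ suc (firstZeroPos b)
firstZeroPos-odd b with (1 + b * 2) % 2 | [m+kn]%n≡m%n 1 b 2
... | .1 | refl = cong suc (begin
  trailingOnesFuel (b * 2) ((1 + b * 2) / 2)
    ≡⟨ cong (trailingOnesFuel (b * 2)) ([1+b*2]/2≡b b) ⟩
  trailingOnesFuel (b * 2) b
    ≡⟨ trailingOnesFuel-irrelevant (b * 2) b b (m≤m*n b 2) ≤-refl ⟩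
  firstZeroPos b
    ∎)
  where open ≡-Reasoning

roundDownPow2 : ℕ → ℕ → ℕ
roundDownPow2 z m = 2 ^ z * (_/_ m (2 ^ z) {{m^n≢0 2 z}})

roundDownPow2-zero : ∀ m → roundDownPow2 0 m ≡ m
roundDownPow2-zero m = trans (+-identityʳ (m / 1)) (n/1≡n m)

roundDownPow2-odd : ∀ z b → roundDownPow2 (suc z) (1 + b * 2) ≡ roundDownPow2 z b * 2
roundDownPow2-odd z b = begin
  2 * 2 ^ z * ((1 + b * 2) / (2 * 2 ^ z))  ≡⟨ cong (2 * 2 ^ z *_) halve ⟩
  2 * 2 ^ z * (b / 2 ^ z)                  ≡⟨ *-assoc 2 (2 ^ z) (b / 2 ^ z) ⟩
  2 * roundDownPow2 z b                    ≡⟨ *-comm 2 (roundDownPow2 z b) ⟩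
  roundDownPow2 z b * 2                    ∎
  where
  open ≡-Reasoning
  instance
    2^z≢0 : NonZero (2 ^ z)
    2^z≢0 = m^n≢0 2 z
    2^[1+z]≢0 : NonZero (2 * 2 ^ z)
    2^[1+z]≢0 = m^n≢0 2 (suc z)
  halve : (1 + b * 2) / (2 * 2 ^ z) ≡ b / 2 ^ z
  halve = trans (sym (m/n/o≡m/[n*o] (1 + b * 2) 2 (2 ^ z))) (/-congˡ ([1+b*2]/2≡b b))

roundDownPow2-≤ : ∀ z m → roundDownPow2 z m ≤ m
roundDownPow2-≤ z m = subst (_≤ m) (*-comm (m / 2 ^ z) (2 ^ z)) (m/n*n≤m m (2 ^ z))
  where
  instance
    2^z≢0 : NonZero (2 ^ z)
    2^z≢0 = m^n≢0 2 z

clearTrailingOnes : ℕ → ℕ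
clearTrailingOnes m = roundDownPow2 (firstZeroPos m) m

clearTrailingOnes-even : ∀ b → clearTrailingOnes (b * 2) ≡ b * 2
clearTrailingOnes-even b =
  trans (cong (λ z → roundDownPow2 z (b * 2)) (firstZeroPos-even b)) (roundDownPow2-zero (b * 2))

clearTrailingOnes-odd : ∀ b → clearTrailingOnes (1 + b * 2) ≡ clearTrailingOnes b * 2
clearTrailingOnes-odd b = trans (cong (λ z → roundDownPow2 z (1 + b * 2)) (firstZeroPos-odd b))
                                (roundDownPow2-odd (firstZeroPos b) b)

clearTrailingOnes-≤ : ∀ m → clearTrailingOnes m ≤ m
clearTrailingOnes-≤ m = roundDownPow2-≤ (firstZeroPos m) m

clearTrailingOnes-isEven : ∀ m → ∃[ c ] clearTrailingOnes m ≡ c * 2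
clearTrailingOnes-isEven m with parityView m
... | even b = b , clearTrailingOnes-even b
... | odd b  = clearTrailingOnes b , clearTrailingOnes-odd b

P₁-even : ∀ b → P₁ (b * 2) ≡ b * 2 ∸ 1
P₁-even b = cong (_∸ 1) (clearTrailingOnes-even b)

P₁-odd : ∀ b → P₁ (1 + b * 2) ≡ clearTrailingOnes b * 2 ∸ 1
P₁-odd b = cong (_∸ 1) (clearTrailingOnes-odd b)

P₁-< : ∀ m → P₁ (suc m) ≤ m
P₁-< m = ∸-monoˡ-≤ 1 (clearTrailingOnes-≤ (suc m))

-- The fuel m suffices, since P₁ m < m for m > 0.
depthWithin : ℕ → ℕ → ℕ
depthWithin zero    _       = 0
depthWithin (suc f) zero    = 0
depthWithin (suc f) (suc m) = suc (depthWithin f (P₁ (suc m)))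

pruningDepth : ℕ → ℕ
pruningDepth m = depthWithin m m

depthWithin-irrelevant : ∀ f g m → m ≤ f → m ≤ g → depthWithin f m ≡ depthWithin g m
depthWithin-irrelevant zero    zero    _       _         _         = refl
depthWithin-irrelevant zero    (suc g) zero    _         _         = refl
depthWithin-irrelevant (suc f) zero    zero    _         _         = refl
depthWithin-irrelevant (suc f) (suc g) zero    _         _         = refl
depthWithin-irrelevant (suc f) (suc g) (suc m) (s≤s m≤f) (s≤s m≤g) =
  cong suc (depthWithin-irrelevant f g (P₁ (suc m)) (≤-trans (P₁-< m) m≤f) (≤-trans (P₁-< m) m≤g))

pruningDepth-suc : ∀ m → pruningDepth (suc m) ≡ suc (pruningDepth (P₁ (suc m)))
pruningDepth-suc m = cong suc (depthWithin-irrelevant m (P₁ (suc m)) (P₁ (suc m)) (P₁-< m) ≤-refl)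

pruningDepth-odd : ∀ b → pruningDepth (1 + suc b * 2) ≡ pruningDepth (suc b)
pruningDepth-odd b = go b (<-wellFounded (suc b))
  where
  go : ∀ b → Acc _<_ (suc b) → pruningDepth (1 + suc b * 2) ≡ pruningDepth (suc b)
  go b (acc rec) with clearTrailingOnes-isEven (suc b)
  ... | c , ct≡c*2 = begin
    pruningDepth (1 + suc b * 2)
      ≡⟨ pruningDepth-suc (suc b * 2) ⟩
    suc (pruningDepth (P₁ (1 + suc b * 2)))
      ≡⟨ cong (λ t → suc (pruningDepth t)) (P₁-odd (suc b)) ⟩
    suc (pruningDepth (clearTrailingOnes (suc b) * 2 ∸ 1))
      ≡⟨ cong (λ t → suc (pruningDepth (t * 2 ∸ 1))) ct≡c*2 ⟩
    suc (pruningDepth (c * 2 * 2 ∸ 1))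
      ≡⟨ cong suc (shrink c (subst (_≤ suc b) ct≡c*2 (clearTrailingOnes-≤ (suc b)))) ⟩
    suc (pruningDepth (c * 2 ∸ 1))
      ≡⟨ cong (λ t → suc (pruningDepth (t ∸ 1))) ct≡c*2 ⟨
    suc (pruningDepth (P₁ (suc b)))
      ≡⟨ pruningDepth-suc b ⟨
    pruningDepth (suc b)
      ∎
    where
    open ≡-Reasoning
    -- For c = 1 + c′ the two arguments reduce to 1 + (1 + c′ * 2) * 2 and 1 + c′ * 2.
    shrink : ∀ c → c * 2 ≤ suc b → pruningDepth (c * 2 * 2 ∸ 1) ≡ pruningDepth (c * 2 ∸ 1)
    shrink zero    _        = refl
    shrink (suc c) 2c+1<1+b = go (c * 2) (rec 2c+1<1+b)

b*2<2^[1+k]⇒b<2^k : ∀ b k → b * 2 < 2 ^ suc k → b < 2 ^ k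
b*2<2^[1+k]⇒b<2^k b k lt = *-cancelʳ-< 2 b (2 ^ k) (subst (b * 2 <_) (*-comm 2 (2 ^ k)) lt)

1<2^k⇒1≤k : ∀ k → 1 < 2 ^ k → 1 ≤ k
1<2^k⇒1≤k zero    (s≤s ())
1<2^k⇒1≤k (suc k) _ = s≤s z≤n

pruningDepth-<2^ : ∀ k m → m < 2 ^ k → pruningDepth m ≤ k
pruningDepth-<2^ zero    zero    _         = z≤n
pruningDepth-<2^ zero    (suc m) (s≤s ())
pruningDepth-<2^ (suc k) m       m<2^[1+k] with parityView m
... | even zero    = z≤n
... | odd  zero    = s≤s z≤n
... | odd  (suc a) = subst (_≤ suc k) (sym (pruningDepth-odd a))
  (m≤n⇒m≤1+n (pruningDepth-<2^ k (suc a) (b*2<2^[1+k]⇒b<2^k (suc a) k (<-trans (n<1+n _) m<2^[1+k]))))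
... | even (suc a) = subst (_≤ suc k) (sym depth≡)
  (s≤s (odd≤k a (b*2<2^[1+k]⇒b<2^k (suc a) k m<2^[1+k])))
  where
  depth≡ : pruningDepth (suc a * 2) ≡ suc (pruningDepth (1 + a * 2))
  depth≡ = trans (pruningDepth-suc (suc (a * 2))) (cong (λ t → suc (pruningDepth t)) (P₁-even (suc a)))
  odd≤k : ∀ a → suc a < 2 ^ k → pruningDepth (1 + a * 2) ≤ k
  odd≤k zero    1<2^k   = 1<2^k⇒1≤k k 1<2^k
  odd≤k (suc a) 2+a<2^k =
    subst (_≤ k) (sym (pruningDepth-odd a)) (pruningDepth-<2^ k (suc a) (<-trans (n<1+n _) 2+a<2^k))

ones : ℕ → ℕ
ones zero    = 0
ones (suc n) = 1 + ones n * 2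

ones≡2^∸1 : ∀ n → ones n ≡ 2 ^ n ∸ 1
ones≡2^∸1 n = cong (_∸ 1) (1+ones≡2^ n)
  where
  1+ones≡2^ : ∀ n → suc (ones n) ≡ 2 ^ n
  1+ones≡2^ zero    = refl
  1+ones≡2^ (suc n) = trans (cong (_* 2) (1+ones≡2^ n)) (*-comm (2 ^ n) 2)

weight-≤-potential : ∀ {k n} (φ : ℕ → ℤ) →
                     (∀ {u v w} → Edge k n u v w → w ℤ.+ φ u ℤ.≤ φ v) →
                     ∀ {u v} (p : Path k n u v) → weight p ℤ.+ φ u ℤ.≤ φ v
weight-≤-potential φ edge-≤ {u} []      = ℤ.≤-reflexive (ℤ.+-identityˡ (φ u))
weight-≤-potential φ edge-≤ {u} {v} (_∷_ {v = t} {w = w} e p) = begin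
  (w ℤ.+ weight p) ℤ.+ φ u   ≡⟨ cong (ℤ._+ φ u) (ℤ.+-comm w (weight p)) ⟩
  (weight p ℤ.+ w) ℤ.+ φ u   ≡⟨ ℤ.+-assoc (weight p) w (φ u) ⟩
  weight p ℤ.+ (w ℤ.+ φ u)   ≤⟨ ℤ.+-monoʳ-≤ (weight p) (edge-≤ e) ⟩
  weight p ℤ.+ φ t           ≤⟨ weight-≤-potential φ edge-≤ p ⟩
  φ v                        ∎
  where open ℤ.≤-Reasoning

-- No red edge ends at the target 2ᵏ − 1, so its potential may be lowered from its depth 1 to 0.
potential : ℕ → ℕ → ℕ
potential t m with m ≟ t
... | yes _ = 0
... | no  _ = pruningDepth m

potential-≤ : ∀ t m → potential t m ≤ pruningDepth m
potential-≤ t m with m ≟ t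
... | yes _ = z≤n
... | no  _ = ≤-refl

potential-target : ∀ t → potential t t ≡ 0
potential-target t with t ≟ t
... | yes _   = refl
... | no  t≢t = contradiction refl t≢t

potential-P₁ : ∀ t m → 1 ≤ m → m ≢ t → suc (potential t (P₁ m)) ≤ potential t m
potential-P₁ t (suc m) _ m≢t with suc m ≟ t
... | yes m≡t = contradiction m≡t m≢t
... | no  _   = subst (suc (potential t (P₁ (suc m))) ≤_) (sym (pruningDepth-suc m))
                      (s≤s (potential-≤ t (P₁ (suc m))))

1≤2^[k∸1]∸1 : ∀ {k} → 2 ≤ k → 1 ≤ 2 ^ (k ∸ 1) ∸ 1
1≤2^[k∸1]∸1 {suc zero}    (s≤s ())
1≤2^[k∸1]∸1 {suc (suc k)} _ = subst (1 ≤_) (ones≡2^∸1 (suc k)) (s≤s z≤n)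

module _ {k n : ℕ} (2≤k : 2 ≤ k) (k≤n : k ≤ n) where

  private
    target = 2 ^ k ∸ 1

  edge-≤-potential : ∀ {u v w} → Edge k n u v w → w ℤ.+ + potential target u ℤ.≤ + potential target v
  edge-≤-potential (blue m _ m<target) = begin
    - + n ℤ.+ + potential target m   ≤⟨ ℤ.+-monoʳ-≤ (- + n) (+≤+ potential≤n) ⟩
    - + n ℤ.+ + n                    ≡⟨ ℤ.+-inverseˡ (+ n) ⟩
    + 0                              ≤⟨ +≤+ z≤n ⟩
    + potential target (suc m)       ∎
    where
    open ℤ.≤-Reasoning
    potential≤n : potential target m ≤ n
    potential≤n = ≤-trans (potential-≤ target m)
      (≤-trans (pruningDepth-<2^ k m (≤-trans m<target (m∸n≤m (2 ^ k) 1))) k≤n)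
  -- Here 2 ≤ k is needed: for k = 1 the red loop P₁ 0 = 0 → 0 makes weights unbounded.
  edge-≤-potential (red m first≤m m<target) =
    +≤+ (potential-P₁ target m (≤-trans (1≤2^[k∸1]∸1 2≤k) first≤m) (<⇒≢ m<target))

  weight-≤-0 : (p : Path k n 0 target) → weight p ℤ.≤ + 0
  weight-≤-0 p = subst₂ ℤ._≤_
    (trans (cong (λ x → weight p ℤ.+ + x) potential-0) (ℤ.+-identityʳ (weight p)))
    (cong +_ (potential-target target))
    (weight-≤-potential (λ m → + potential target m) edge-≤-potential p)
    where
    potential-0 : potential target 0 ≡ 0
    potential-0 = n≤0⇒n≡0 (potential-≤ target 0)

onesZeroOnes : ℕ → ℕ → ℕ
onesZeroOnes i zero    = ones i * 2
onesZeroOnes i (suc j) = 1 + onesZeroOnes i j * 2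

clearTrailingOnes-zeroOnes : ∀ j → clearTrailingOnes (onesZeroOnes 0 j) ≡ 0
clearTrailingOnes-zeroOnes zero    = clearTrailingOnes-even 0
clearTrailingOnes-zeroOnes (suc j) =
  trans (clearTrailingOnes-odd (onesZeroOnes 0 j)) (cong (_* 2) (clearTrailingOnes-zeroOnes j))

clearTrailingOnes-onesZeroOnes :
  ∀ i j → clearTrailingOnes (onesZeroOnes (suc i) j) ≡ suc (onesZeroOnes i (suc j))
clearTrailingOnes-onesZeroOnes i zero    = clearTrailingOnes-even (ones (suc i))
clearTrailingOnes-onesZeroOnes i (suc j) =
  trans (clearTrailingOnes-odd (onesZeroOnes (suc i) j)) (cong (_* 2) (clearTrailingOnes-onesZeroOnes i j))

P₁-zeroOnes : ∀ j → P₁ (onesZeroOnes 0 j) ≡ 0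
P₁-zeroOnes j = cong (_∸ 1) (clearTrailingOnes-zeroOnes j)

P₁-onesZeroOnes : ∀ i j → P₁ (onesZeroOnes (suc i) j) ≡ onesZeroOnes i (suc j)
P₁-onesZeroOnes i j = cong (_∸ 1) (clearTrailingOnes-onesZeroOnes i j)

ones-≤-onesZeroOnes : ∀ i j → ones (i + j) ≤ onesZeroOnes i j
ones-≤-onesZeroOnes i zero    =
  subst (λ t → ones t ≤ ones i * 2) (sym (+-identityʳ i)) (m≤m*n (ones i) 2)
ones-≤-onesZeroOnes i (suc j) =
  subst (λ t → ones t ≤ onesZeroOnes i (suc j)) (sym (+-suc i j))
    (s≤s (*-monoˡ-≤ 2 (ones-≤-onesZeroOnes i j)))

onesZeroOnes-<-ones : ∀ i j → onesZeroOnes i j < ones (suc (i + j))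
onesZeroOnes-<-ones i zero    =
  subst (λ t → ones i * 2 < ones (suc t)) (sym (+-identityʳ i)) ≤-refl
onesZeroOnes-<-ones i (suc j) =
  subst (λ t → onesZeroOnes i (suc j) < ones (suc t)) (sym (+-suc i j))
    (s≤s (≤-trans (n≤1+n _) (*-monoˡ-≤ 2 (onesZeroOnes-<-ones i j))))

Edge-cast : ∀ {k n u u′ v v′ w} → u ≡ u′ → v ≡ v′ → Edge k n u v w → Edge k n u′ v′ w
Edge-cast refl refl e = e

module _ (K n : ℕ) where

  private
    k = suc K

    firstNode≤ : ∀ i j → i + j ≡ K → 2 ^ (k ∸ 1) ∸ 1 ≤ onesZeroOnes i j
    firstNode≤ i j i+j≡K =
      subst (_≤ onesZeroOnes i j) (trans (cong ones i+j≡K) (ones≡2^∸1 K)) (ones-≤-onesZeroOnes i j)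

    <target : ∀ i j → i + j ≡ K → onesZeroOnes i j < 2 ^ k ∸ 1
    <target i j i+j≡K =
      subst (onesZeroOnes i j <_) (trans (cong (ones ∘ suc) i+j≡K) (ones≡2^∸1 k)) (onesZeroOnes-<-ones i j)

  climb : ∀ i j → i + j ≡ K →
          Σ (Path k n (onesZeroOnes i j) (2 ^ k ∸ 1)) (λ p → weight p ≡ + j ℤ.- + n)
  climb i zero i+0≡K =
    Edge-cast refl 1+node≡target (blue _ (firstNode≤ i 0 i+0≡K) (<target i 0 i+0≡K)) ∷ [] ,
    trans (ℤ.+-identityʳ (- + n)) (sym (ℤ.+-identityˡ (- + n)))
    where
    1+node≡target : ones (suc i) ≡ 2 ^ k ∸ 1
    1+node≡target = trans (cong (ones ∘ suc) (trans (sym (+-identityʳ i)) i+0≡K)) (ones≡2^∸1 k)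
  climb i (suc j) i+[1+j]≡K =
    let p , p≡j-n = climb (suc i) j 1+i+j≡K in
    Edge-cast (P₁-onesZeroOnes i j) refl
      (red _ (firstNode≤ (suc i) j 1+i+j≡K) (<target (suc i) j 1+i+j≡K)) ∷ p ,
    trans (cong (ℤ._+_ (+ 1)) p≡j-n) (sym (ℤ.+-assoc (+ 1) (+ j) (- + n)))
    where
    1+i+j≡K : suc i + j ≡ K
    1+i+j≡K = trans (sym (+-suc i j)) i+[1+j]≡K

  path-of-weight-k-n : Σ (Path k n 0 (2 ^ k ∸ 1)) (λ p → weight p ≡ + k ℤ.- + n)
  path-of-weight-k-n =
    let p , p≡K-n = climb 0 K refl in
    Edge-cast (P₁-zeroOnes K) refl (red _ (firstNode≤ 0 K refl) (<target 0 K refl)) ∷ p ,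
    trans (cong (ℤ._+_ (+ 1)) p≡K-n) (sym (ℤ.+-assoc (+ 1) (+ K) (- + n)))

mainTheorem4 : (k : ℕ) → 2 ≤ k →
    (Σ (Path k k 0 (2 ^ k ∸ 1)) (λ p → weight p ≡ + 0))
      × ((p : Path k k 0 (2 ^ k ∸ 1)) → weight p ℤ.≤ + 0)
mainTheorem4 k@(suc K) 2≤k =
  let p , p≡k-k = path-of-weight-k-n K k in
  (p , trans p≡k-k (ℤ.+-inverseʳ (+ k))) , weight-≤-0 2≤k ≤-refl
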